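{- Let $G$ be a finite digraph with non-empty vertex set $V(G)$, where arrows are ordered pairs of vertices (so there is at most one arrow from a vertex $u$ to a vertex $v$, and loops $(u,u)$ are allowed). Then there exist a finite-dimensional algebra $A$ over $\mathbb{F}$ and a basis of $A$ such that the (unweighted) action to the right digraph $G_R(A)$ of $A$ with respect to this basis is isomorphic to $G$. The same holds for the action to the left digraph $G_L(A)$.
   Context: Throughout, $\mathbb{F}$ is an algebraically closed field of characteristic zero, and an algebra is a finite-dimensional $\mathbb{F}$-vector space $A$ with a bilinear product $*$ (not necessarily associative). Given a basis $\{x_1,\dots,x_n\}$ of $A$, write $x_i*x_j=\sum_{l=1}^n c_{ij}^l x_l$ with $c_{ij}^l\in\mathbb{F}$. The action to the right digraph $G_R(A)$ has vertex set $\{x_1,\dots,x_n\}$ and an arrow from $x_i$ to $x_l$ if and only if $c_{ij}^l\neq 0$ for some $j$ (with weight the vector $(c_{ij}^l)_j$). The action to the left digraph $G_L(A)$ has vertex set $\{x_1,\dots,x_n\}$ and an arrow from $x_j$ to $x_l$ if and only if $c_{ij}^l\neq 0$ for some $i$. Two digraphs $G,H$ are isomorphic if there is a bijection $f:V(G)\to V(H)$ with $(v_1,v_2)\in A(G)$ iff $(f(v_1),f(v_2))\in A(H)$. -}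

module Defs where

open import Level using (Level; _⊔_) renaming (suc to lsuc)
open import Data.Nat using (ℕ; zero; suc)
open import Data.Fin using (Fin)
open import Data.Bool using (Bool; true)
open import Data.List using (List; []; _∷_)
open import Data.Product using (Σ; ∃; ∃-syntax; _×_; _,_)
open import Function.Bundles using (Inverse; _↔_; _⇔_)
open import Relation.Nullary using (¬_)
open import Relation.Binary.PropositionalEquality using (_≡_)
open import Algebra.Bundles using (CommutativeRing)

record Field (c ℓ : Level) : Set (lsuc (c ⊔ ℓ)) where
  field
    commutativeRing : CommutativeRing c ℓ
  open CommutativeRing commutativeRing public
  field
    1≉0     : ¬ (1# ≈ 0#)
    inverse : ∀ x → ¬ (x ≈ 0#) → Σ Carrier λ y → (x * y) ≈ 1#

module _ {c ℓ : Level} (F : Field c ℓ) where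
  open Field F

  eval : List Carrier → Carrier → Carrier
  eval []       x = 0#
  eval (a ∷ as) x = a + (x * eval as x)

  -- polynomial a₀ + a₁ X + … + aₙ Xⁿ with n ≥ 1 and aₙ ≉ 0
  -- represented as (a₀ ∷ as) with leading coefficient aₙ given separately
  evalNC : Carrier → List Carrier → Carrier → Carrier → Carrier
  evalNC a₀ as aₙ x = a₀ + (x * evalLead as x)
    where
    evalLead : List Carrier → Carrier → Carrier
    evalLead []       x = aₙ
    evalLead (b ∷ bs) x = b + (x * evalLead bs x)

  AlgebraicallyClosed : Set (c ⊔ ℓ)
  AlgebraicallyClosed =
    ∀ (a₀ : Carrier) (as : List Carrier) (aₙ : Carrier) → ¬ (aₙ ≈ 0#) →
      Σ Carrier λ x → evalNC a₀ as aₙ x ≈ 0#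

  natₑ : ℕ → Carrier
  natₑ zero    = 0#
  natₑ (suc n) = 1# + natₑ n

  CharacteristicZero : Set ℓ
  CharacteristicZero = ∀ n → ¬ (natₑ (suc n) ≈ 0#)

  -- An n-dimensional algebra over F together with a basis x₀,…,x_{n-1}
  -- is given by its structure constants: x_i * x_j = Σ_l c i j l x_l.
  StructureConstants : ℕ → Set c
  StructureConstants n = Fin n → Fin n → Fin n → Carrier

  RightArrow : ∀ {n} → StructureConstants n → Fin n → Fin n → Set ℓ
  RightArrow c i l = ∃[ j ] ¬ (c i j l ≈ 0#)

  LeftArrow : ∀ {n} → StructureConstants n → Fin n → Fin n → Set ℓ
  LeftArrow c j l = ∃[ i ] ¬ (c i j l ≈ 0#)

Digraph : ℕ → Set
Digraph m = Fin m → Fin m → Bool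

IsoTo : ∀ {ℓ} {n m : ℕ} → (Fin n → Fin n → Set ℓ) → Digraph m → Set ℓ
IsoTo {n = n} {m} R E =
  Σ (Fin n ↔ Fin m) λ f →
    ∀ u v → R u v ⇔ (E (Inverse.to f u) (Inverse.to f v) ≡ true)

-- Take the vertices of G as a basis and multiply only on the diagonal:
-- x_i * x_i = Σ_{(i,l) arrow of G} x_l and x_i * x_j = 0 for i ≠ j.  Then
-- c_{ij}^l ≠ 0 exactly when i = j and (j, l) is an arrow, so both G_R(A) and
-- G_L(A) are G itself under the identity on the basis.
module Submission where

open import Defs
open import Level using (Level)
open import Data.Nat using (ℕ; suc)
open import Data.Product using (Σ; _×_; _,_; proj₂)
open import Data.Fin using (Fin; _≟_)
open import Data.Bool using (Bool; true; false)
open import Data.Empty using (⊥-elim)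
open import Relation.Nullary using (¬_; yes; no)
open import Relation.Binary.PropositionalEquality using (_≡_; refl)
open import Function.Bundles using (_⇔_; mk⇔)
open import Function.Construct.Identity using (↔-id)

module DiagonalAlgebra {c ℓ : Level} (F : Field c ℓ) {n : ℕ} (G : Digraph n) where
  open Field F hiding (refl)

  indicator : Bool → Carrier
  indicator true  = 1#
  indicator false = 0#

  indicator≉0⇒true : ∀ b → ¬ (indicator b ≈ 0#) → b ≡ true
  indicator≉0⇒true true  _    = refl
  indicator≉0⇒true false b≉0 = ⊥-elim (b≉0 (Field.refl F))

  diagonalAlgebra : StructureConstants F n
  diagonalAlgebra i j l with i ≟ j
  ... | yes _ = indicator (G j l)
  ... | no  _ = 0#

  diagonalAlgebra≉0⇒diagonal-arrow : ∀ i j l → ¬ (diagonalAlgebra i j l ≈ 0#) →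
                                     i ≡ j × G j l ≡ true
  diagonalAlgebra≉0⇒diagonal-arrow i j l c≉0 with i ≟ j
  ... | yes i≡j = i≡j , indicator≉0⇒true (G j l) c≉0
  ... | no  _   = ⊥-elim (c≉0 (Field.refl F))

  arrow⇒diagonalAlgebra≉0 : ∀ j l → G j l ≡ true → ¬ (diagonalAlgebra j j l ≈ 0#)
  arrow⇒diagonalAlgebra≉0 j l arrow with j ≟ j
  ... | yes _ rewrite arrow = 1≉0
  ... | no j≢j = ⊥-elim (j≢j refl)

  rightArrow⇒arrow : ∀ u v → RightArrow F diagonalAlgebra u v → G u v ≡ true
  rightArrow⇒arrow u v (j , c≉0) with diagonalAlgebra≉0⇒diagonal-arrow u j v c≉0
  ... | refl , arrow = arrow

  leftArrow⇒arrow : ∀ u v → LeftArrow F diagonalAlgebra u v → G u v ≡ true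
  leftArrow⇒arrow u v (i , c≉0) = proj₂ (diagonalAlgebra≉0⇒diagonal-arrow i u v c≉0)

  rightArrow⇔arrow : ∀ u v → RightArrow F diagonalAlgebra u v ⇔ (G u v ≡ true)
  rightArrow⇔arrow u v = mk⇔ (rightArrow⇒arrow u v) (λ arrow → u , arrow⇒diagonalAlgebra≉0 u v arrow)

  leftArrow⇔arrow : ∀ u v → LeftArrow F diagonalAlgebra u v ⇔ (G u v ≡ true)
  leftArrow⇔arrow u v = mk⇔ (leftArrow⇒arrow u v) (λ arrow → u , arrow⇒diagonalAlgebra≉0 u v arrow)

proposition3p1 : ∀ {c ℓ : Level} (F : Field c ℓ) → AlgebraicallyClosed F → CharacteristicZero F →
    ∀ (m : ℕ) (G : Digraph (suc m)) →
      (Σ ℕ λ n → Σ (StructureConstants F n) λ c → IsoTo (RightArrow F c) G)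
      × (Σ ℕ λ n → Σ (StructureConstants F n) λ c → IsoTo (LeftArrow F c) G)
proposition3p1 F _ _ m G =
  (suc m , diagonalAlgebra , ↔-id _ , rightArrow⇔arrow) ,
  (suc m , diagonalAlgebra , ↔-id _ , leftArrow⇔arrow)
  where open DiagonalAlgebra F G
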